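{- Let $x,y\ge 2$ be integers and let $p$ be a prime that divides $x$. Then for each $j$ with $2\le j\le y$, \[ v_p(xy)\le v_p\!\left(\binom{y}{j}x^{j}\right). \] Moreover, equality holds if and only if $(p,j)=(2,2)$, $x\equiv 2 \pmod 4$, and $y$ is even.
   Context: $v_p(n)$ denotes the $p$-adic valuation of a nonzero integer $n$, i.e. the exponent of the largest power of $p$ dividing $n$. -}

module Defs where

open import Data.Nat using (ℕ; suc; _^_)
open import Data.Nat.Divisibility using (_∣_)
open import Data.Product using (_×_)
open import Relation.Nullary using (¬_)

-- IsValuation p n k  :  v_p(n) = k, i.e. p^k ∣ n and p^(k+1) ∤ n.
-- (For n ≠ 0 and p prime such k exists and is unique.)
IsValuation : ℕ → ℕ → ℕ → Set
IsValuation p n k = (p ^ k ∣ n) × ¬ (p ^ suc k ∣ n)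

-- Absorption j·C(y,j) = y·C(y−1,j−1) gives j · C(y,j)x^j = xy · C(y−1,j−1)x^(j−1).
-- Write j = p^d·m with p ∤ m. If p^(d+1) divides the last factor, comparing p-adic valuations
-- gives v_p(C(y,j)x^j) > v_p(xy). As p ∣ x, that factor is divisible by p^(j−1), and d + 1 ≤ j − 1
-- unless (p,j) = (2,2). In that case the identity reads C(y,2)x² = xy · (y−1)(x/2): the valuations
-- agree when y − 1 and x/2 are both odd, and otherwise 4 divides (y−1)x.
module Submission where

open import Defs
open import Data.Nat using (ℕ; zero; suc; _+_; _*_; _^_; _≤_; _<_; _%_; _/_; z≤n; s≤s; NonZero; _≟_; nonTrivial⇒n>1)
open import Data.Nat.Properties
open import Data.Nat.Divisibility
open import Data.Nat.DivMod using (m≡m%n+[m/n]*n; m%n<n)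
open import Data.Nat.Primality using (Prime; prime[2]; euclidsLemma; prime⇒nonZero; prime⇒nonTrivial)
open import Data.Nat.Combinatorics using (_C_; nCk+nC[k+1]≡[n+1]C[k+1]; nC1≡n)
open import Data.Nat.Induction using (<-rec)
open import Data.Nat.Tactic.RingSolver using (solve-∀)
open import Data.Product using (_×_; _,_; ∃₂)
open import Data.Sum using (_⊎_; inj₁; inj₂)
open import Function.Bundles using (_⇔_; mk⇔)
open import Relation.Nullary using (¬_; yes; no; contradiction)
open import Relation.Nullary.Decidable using (_×-dec_)
open import Relation.Binary.PropositionalEquality

[k+1]*[n+1]C[k+1]≡[n+1]*nCk : ∀ n k → suc k * (suc n C suc k) ≡ suc n * (n C k)
[k+1]*[n+1]C[k+1]≡[n+1]*nCk zero    zero    = refl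
[k+1]*[n+1]C[k+1]≡[n+1]*nCk zero    (suc k) = *-zeroʳ (suc (suc k))
[k+1]*[n+1]C[k+1]≡[n+1]*nCk (suc n) zero    = trans (*-identityˡ _) (trans (nC1≡n (suc (suc n))) (sym (*-identityʳ _)))
[k+1]*[n+1]C[k+1]≡[n+1]*nCk (suc n) (suc k) = begin
  (2 + k) * ((2 + n) C (2 + k))
    ≡⟨ cong ((2 + k) *_) (sym (nCk+nC[k+1]≡[n+1]C[k+1] (suc n) (suc k))) ⟩
  (2 + k) * (A + B)
    ≡⟨ split (suc n C suc k) (suc n C suc (suc k)) k ⟩
  (1 + k) * A + A + (2 + k) * B
    ≡⟨ cong₂ (λ u v → u + A + v) ([k+1]*[n+1]C[k+1]≡[n+1]*nCk n k) ([k+1]*[n+1]C[k+1]≡[n+1]*nCk n (suc k)) ⟩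
  (1 + n) * (n C k) + A + (1 + n) * (n C suc k)
    ≡⟨ merge (suc n) (n C k) (n C suc k) A ⟩
  (1 + n) * (n C k + n C suc k) + A
    ≡⟨ cong (λ u → (1 + n) * u + A) (nCk+nC[k+1]≡[n+1]C[k+1] n k) ⟩
  (1 + n) * A + A
    ≡⟨ +-comm ((1 + n) * A) A ⟩
  (2 + n) * A ∎
  where
  open ≡-Reasoning
  A B : ℕ
  A = suc n C suc k
  B = suc n C suc (suc k)
  split : ∀ a b k → (2 + k) * (a + b) ≡ (1 + k) * a + a + (2 + k) * b
  split = solve-∀
  merge : ∀ s a b c → s * a + c + s * b ≡ s * (a + b) + c
  merge = solve-∀

weighted-absorption : ∀ n k x →
  suc k * ((suc n C suc k) * x ^ suc k) ≡ x * suc n * ((n C k) * x ^ k)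
weighted-absorption n k x = begin
  suc k * ((suc n C suc k) * x ^ suc k)  ≡⟨ sym (*-assoc (suc k) (suc n C suc k) (x ^ suc k)) ⟩
  suc k * (suc n C suc k) * x ^ suc k    ≡⟨ cong (_* x ^ suc k) ([k+1]*[n+1]C[k+1]≡[n+1]*nCk n k) ⟩
  suc n * (n C k) * (x * x ^ k)          ≡⟨ shuffle (suc n) (n C k) x (x ^ k) ⟩
  x * suc n * ((n C k) * x ^ k)          ∎
  where
  open ≡-Reasoning
  shuffle : ∀ a b c d → a * b * (c * d) ≡ c * a * (b * d)
  shuffle = solve-∀

2∣n⊎2∣1+n : ∀ n → 2 ∣ n ⊎ 2 ∣ suc n
2∣n⊎2∣1+n zero = inj₁ (2 ∣0)
2∣n⊎2∣1+n (suc n) with 2∣n⊎2∣1+n n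
... | inj₁ 2∣n   = inj₂ (∣m∣n⇒∣m+n (∣-refl {2}) 2∣n)
... | inj₂ 2∣1+n = inj₁ 2∣1+n

2∣n⇒2∤1+n : ∀ {n} → 2 ∣ n → ¬ 2 ∣ suc n
2∣n⇒2∤1+n {n} 2∣n 2∣1+n with ∣1⇒≡1 (∣m+n∣m⇒∣n (subst (2 ∣_) (+-comm 1 n) 2∣1+n) 2∣n)
... | ()

2∣n⇒n%4≡2⊎4∣n : ∀ n → 2 ∣ n → n % 4 ≡ 2 ⊎ 4 ∣ n
2∣n⇒n%4≡2⊎4∣n n 2∣n with n % 4 in eq | m%n<n n 4 | %-presˡ-∣ 2∣n (divides 2 refl)
... | 0 | _ | _   = inj₂ (m%n≡0⇒n∣m n 4 eq)
... | 1 | _ | 2∣1 = contradiction 2∣1 (2∣n⇒2∤1+n (2 ∣0))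
... | 2 | _ | _   = inj₁ refl
... | 3 | _ | 2∣3 = contradiction 2∣3 (2∣n⇒2∤1+n (∣-refl {2}))
... | suc (suc (suc (suc _))) | s≤s (s≤s (s≤s (s≤s ()))) | _

n%4≡2⇒n≡2*odd : ∀ n → n % 4 ≡ 2 → ∃₂ λ u (_ : ¬ 2 ∣ u) → n ≡ 2 * u
n%4≡2⇒n≡2*odd n n%4≡2 =
  suc (2 * (n / 4)) , 2∣n⇒2∤1+n (m∣m*n (n / 4)) ,
  trans (m≡m%n+[m/n]*n n 4) (trans (cong (_+ n / 4 * 4) n%4≡2) (halve (n / 4)))
  where
  halve : ∀ t → 2 + t * 4 ≡ 2 * suc (2 * t)
  halve = solve-∀

^-monoʳ-∣ : ∀ p {k l} → k ≤ l → p ^ k ∣ p ^ l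
^-monoʳ-∣ p {l = l} z≤n = 1∣ (p ^ l)
^-monoʳ-∣ p (s≤s k≤l)   = *-monoʳ-∣ p (^-monoʳ-∣ p k≤l)

^-monoˡ-∣ : ∀ {m n} k → m ∣ n → m ^ k ∣ n ^ k
^-monoˡ-∣ zero    m∣n = ∣-refl
^-monoˡ-∣ (suc k) m∣n = *-pres-∣ m∣n (^-monoˡ-∣ k m∣n)

p^k∣m*n⇒p^k∣n : ∀ {p m n} k → Prime p → ¬ p ∣ m → p ^ k ∣ m * n → p ^ k ∣ n
p^k∣m*n⇒p^k∣n {n = n} zero _ _ _ = 1∣ n
p^k∣m*n⇒p^k∣n {p} {m} {n} (suc k) pp p∤m p^[1+k]∣mn
  with euclidsLemma m n pp (∣-trans (m∣m*n (p ^ k)) p^[1+k]∣mn)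
... | inj₁ p∣m = contradiction p∣m p∤m
... | inj₂ (divides q refl) =
  subst (p * p ^ k ∣_) (*-comm p q) (*-monoʳ-∣ p (p^k∣m*n⇒p^k∣n k pp p∤m p^k∣mq))
  where
  instance _ = prime⇒nonZero pp
  pull : ∀ m q p → m * (q * p) ≡ p * (m * q)
  pull = solve-∀
  p^k∣mq : p ^ k ∣ m * q
  p^k∣mq = *-cancelˡ-∣ p (subst (p * p ^ k ∣_) (pull m q p) p^[1+k]∣mn)

p^k∣n⇒k≤valuation : ∀ {p n k b} → p ^ k ∣ n → ¬ p ^ suc b ∣ n → k ≤ b
p^k∣n⇒k≤valuation {p} {k = k} {b} p^k∣n p^[1+b]∤n with k ≤? b
... | yes k≤b = k≤b
... | no k≰b  = contradiction (∣-trans (^-monoʳ-∣ p (≰⇒> k≰b)) p^k∣n) p^[1+b]∤n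

isValuation-unique : ∀ {p n a b} → IsValuation p n a → IsValuation p n b → a ≡ b
isValuation-unique (p^a∣n , p^[1+a]∤n) (p^b∣n , p^[1+b]∤n) =
  ≤-antisym (p^k∣n⇒k≤valuation p^a∣n p^[1+b]∤n) (p^k∣n⇒k≤valuation p^b∣n p^[1+a]∤n)

isValuation-*ʳ : ∀ {p n w k} → Prime p → ¬ p ∣ w → IsValuation p n k → IsValuation p (n * w) k
isValuation-*ʳ {p} {n} {w} {k} pp p∤w (p^k∣n , p^[1+k]∤n) =
  ∣m⇒∣m*n w p^k∣n ,
  λ p^[1+k]∣nw → p^[1+k]∤n (p^k∣m*n⇒p^k∣n (suc k) pp p∤w (subst (p ^ suc k ∣_) (*-comm n w) p^[1+k]∣nw))

p^d*m-factorisation : ∀ {p} → Prime p → ∀ n → .{{NonZero n}} → ∃₂ λ d m → n ≡ p ^ d * m × ¬ p ∣ m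
p^d*m-factorisation {p} pp = <-rec _ factor
  where
  Factorisation : ℕ → Set
  Factorisation n = .{{NonZero n}} → ∃₂ λ d m → n ≡ p ^ d * m × ¬ p ∣ m
  regroup : ∀ a m p → a * m * p ≡ p * a * m
  regroup = solve-∀
  factor : ∀ n → (∀ {k} → k < n → Factorisation k) → Factorisation n
  factor n rec with p ∣? n
  ... | no p∤n = 0 , n , sym (+-identityʳ n) , p∤n
  ... | yes (divides q refl)
    with rec (m<m*n q p {{m*n≢0⇒m≢0 q}} (nonTrivial⇒n>1 p {{prime⇒nonTrivial pp}})) {{m*n≢0⇒m≢0 q}}
  ...   | d , m , refl , p∤m = suc d , m , regroup (p ^ d) m p , p∤m

4+n≤2^[2+n] : ∀ n → 4 + n ≤ 2 ^ (2 + n)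
4+n≤2^[2+n] zero    = ≤-refl
4+n≤2^[2+n] (suc n) = begin
  1 + (4 + n)        ≡⟨ +-comm 1 (4 + n) ⟩
  (4 + n) + 1        ≤⟨ +-monoʳ-≤ (4 + n) (s≤s z≤n) ⟩
  2 * (4 + n)        ≤⟨ *-monoʳ-≤ 2 (4+n≤2^[2+n] n) ⟩
  2 * 2 ^ (2 + n)    ∎
  where open ≤-Reasoning

2+d≤j : ∀ {p d m j} → Prime p → j ≡ p ^ d * m → 2 ≤ j → ¬ (p ≡ 2 × j ≡ 2) → 2 + d ≤ j
2+d≤j {p} {d} {zero} _ refl 2≤j _ rewrite *-zeroʳ (p ^ d) with 2≤j
... | ()
2+d≤j {d = zero} _ refl 2≤j _ = 2≤j
2+d≤j {p} {1} {m@(suc _)} pp refl 2≤j ¬[p,j≡2] with p * 1 * m ≟ 2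
... | no j≢2 = ≤∧≢⇒< 2≤j (≢-sym j≢2)
... | yes j≡2 = contradiction (≤-antisym p≤2 (nonTrivial⇒n>1 p {{prime⇒nonTrivial pp}}) , j≡2) ¬[p,j≡2]
  where
  p≤2 : p ≤ 2
  p≤2 = subst₂ _≤_ (*-identityʳ p) j≡2 (m≤m*n (p * 1) m)
2+d≤j {p} {suc (suc e)} {m@(suc _)} pp refl _ _ = begin
  4 + e              ≤⟨ 4+n≤2^[2+n] e ⟩
  2 ^ (2 + e)        ≤⟨ ^-monoˡ-≤ (2 + e) (nonTrivial⇒n>1 p {{prime⇒nonTrivial pp}}) ⟩
  p ^ (2 + e)        ≤⟨ m≤m*n (p ^ (2 + e)) m ⟩
  p ^ (2 + e) * m    ∎
  where open ≤-Reasoning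

-- In j·N = M·K with j = p^d·m, the factors of p in K beyond p^d pass from M to N.
p^a∣M⇒p^[1+a]∣N : ∀ {p d m N M K a} → Prime p → ¬ p ∣ m → p ^ d * m * N ≡ M * K →
                   p ^ suc d ∣ K → p ^ a ∣ M → p ^ suc a ∣ N
p^a∣M⇒p^[1+a]∣N {p} {d} {m} {N} {M} {K} {a} pp p∤m jN≡MK p^[1+d]∣K p^a∣M =
  p^k∣m*n⇒p^k∣n (suc a) pp p∤m (*-cancelˡ-∣ (p ^ d) (subst₂ _∣_ exponents product (*-pres-∣ p^a∣M p^[1+d]∣K)))
  where
  instance _ = m^n≢0 p d {{prime⇒nonZero pp}}
  swap-powers : ∀ p A D → A * (p * D) ≡ D * (p * A)
  swap-powers = solve-∀
  exponents : p ^ a * p ^ suc d ≡ p ^ d * p ^ suc a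
  exponents = swap-powers p (p ^ a) (p ^ d)
  product : M * K ≡ p ^ d * (m * N)
  product = trans (sym jN≡MK) (*-assoc (p ^ d) m N)

EqualityCase : ℕ → ℕ → ℕ → ℕ → Set
EqualityCase x y p j = (p ≡ 2) × (j ≡ 2) × (x % 4 ≡ 2) × (2 ∣ y)

4∣[y-1]*x : ∀ {x y′} → 2 ∣ x → ¬ (x % 4 ≡ 2 × 2 ∣ suc y′) → 4 ∣ y′ * x
4∣[y-1]*x {x} {y′} 2∣x ¬[x%4≡2,2∣y] with 2∣n⇒n%4≡2⊎4∣n x 2∣x
... | inj₂ 4∣x = ∣n⇒∣m*n y′ 4∣x
... | inj₁ x%4≡2 with 2∣n⊎2∣1+n y′
...   | inj₁ 2∣y′ = *-pres-∣ 2∣y′ 2∣x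
...   | inj₂ 2∣y  = contradiction (x%4≡2 , 2∣y) ¬[x%4≡2,2∣y]

valuation-increases : ∀ {x y′ p j′ a} → Prime p → p ∣ x → 2 ≤ suc j′ →
                      ¬ EqualityCase x (suc y′) p (suc j′) →
                      p ^ a ∣ x * suc y′ → p ^ suc a ∣ (suc y′ C suc j′) * x ^ suc j′
valuation-increases {x} {y′} {p} {j′} {a} pp p∣x 2≤j ¬equality p^a∣xy with (p ≟ 2) ×-dec (suc j′ ≟ 2)
... | yes (refl , refl) =
  p^a∣M⇒p^[1+a]∣N {d = 1} {a = a} prime[2] (2∣n⇒2∤1+n (2 ∣0)) (weighted-absorption y′ 1 x) 4∣K p^a∣xy
  where
  4∣K : 4 ∣ (y′ C 1) * x ^ 1
  4∣K = subst (4 ∣_) (sym (cong₂ _*_ (nC1≡n y′) (*-identityʳ x)))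
          (4∣[y-1]*x p∣x λ (x%4≡2 , 2∣y) → ¬equality (refl , refl , x%4≡2 , 2∣y))
... | no ¬[p,j≡2] with p^d*m-factorisation pp (suc j′)
...   | d , m , j≡p^d*m , p∤m = p^a∣M⇒p^[1+a]∣N {d = d} {a = a} pp p∤m p^d*m*N≡xy*K p^[1+d]∣K p^a∣xy
  where
  N : ℕ
  N = (suc y′ C suc j′) * x ^ suc j′
  p^d*m*N≡xy*K : p ^ d * m * N ≡ x * suc y′ * ((y′ C j′) * x ^ j′)
  p^d*m*N≡xy*K = trans (cong (_* N) (sym j≡p^d*m)) (weighted-absorption y′ j′ x)
  p^[1+d]∣p^j′ : p ^ suc d ∣ p ^ j′
  p^[1+d]∣p^j′ = ^-monoʳ-∣ p (≤-pred (2+d≤j {d = d} {m} pp j≡p^d*m 2≤j ¬[p,j≡2]))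
  p^[1+d]∣K : p ^ suc d ∣ (y′ C j′) * x ^ j′
  p^[1+d]∣K = ∣n⇒∣m*n (y′ C j′) (∣-trans p^[1+d]∣p^j′ (^-monoˡ-∣ j′ p∣x))

valuation-preserved : ∀ {x y′ a} → x % 4 ≡ 2 → 2 ∣ suc y′ →
                      IsValuation 2 (x * suc y′) a → IsValuation 2 ((suc y′ C 2) * x ^ 2) a
valuation-preserved {x} {y′} {a} x%4≡2 2∣y v with n%4≡2⇒n≡2*odd x x%4≡2
... | u , u-odd , refl = subst (λ N → IsValuation 2 N a) (sym N≡xy*[y-1]u) (isValuation-*ʳ {k = a} prime[2] [y-1]u-odd v)
  where
  open ≡-Reasoning
  factor-2 : ∀ u y c → 2 * u * y * (c * (2 * u * 1)) ≡ 2 * (2 * u * y * (c * u))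
  factor-2 = solve-∀
  N≡xy*[y-1]u : (suc y′ C 2) * (2 * u) ^ 2 ≡ 2 * u * suc y′ * (y′ * u)
  N≡xy*[y-1]u = *-cancelˡ-≡ _ _ 2 (begin
    2 * ((suc y′ C 2) * (2 * u) ^ 2)               ≡⟨ weighted-absorption y′ 1 (2 * u) ⟩
    2 * u * suc y′ * ((y′ C 1) * (2 * u * 1))      ≡⟨ cong (λ c → 2 * u * suc y′ * (c * (2 * u * 1))) (nC1≡n y′) ⟩
    2 * u * suc y′ * (y′ * (2 * u * 1))            ≡⟨ factor-2 u (suc y′) y′ ⟩
    2 * (2 * u * suc y′ * (y′ * u))                ∎)
  [y-1]u-odd : ¬ 2 ∣ y′ * u
  [y-1]u-odd 2∣[y-1]u with euclidsLemma y′ u prime[2] 2∣[y-1]u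
  ... | inj₁ 2∣y′ = 2∣n⇒2∤1+n 2∣y′ 2∣y
  ... | inj₂ 2∣u  = u-odd 2∣u

lemma2p6 : (x y p j : ℕ) → 2 ≤ x → 2 ≤ y → Prime p → p ∣ x → 2 ≤ j → j ≤ y →
    (a b : ℕ) → IsValuation p (x * y) a → IsValuation p ((y C j) * x ^ j) b →
    (a ≤ b) × ((a ≡ b) ⇔ ((p ≡ 2) × (j ≡ 2) × (x % 4 ≡ 2) × (2 ∣ y)))
lemma2p6 x (suc y′) p (suc j′) _ (s≤s _) pp p∣x 2≤j _ a b va@(p^a∣xy , _) vb@(_ , p^[1+b]∤N)
  with (p ≟ 2) ×-dec (suc j′ ≟ 2) ×-dec (x % 4 ≟ 2) ×-dec (2 ∣? suc y′)
... | yes equality@(refl , refl , x%4≡2 , 2∣y) = ≤-reflexive a≡b , mk⇔ (λ _ → equality) (λ _ → a≡b)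
  where
  a≡b : a ≡ b
  a≡b = isValuation-unique (valuation-preserved {x} {a = a} x%4≡2 2∣y va) vb
... | no ¬equality =
  <⇒≤ a<b , mk⇔ (λ a≡b → contradiction a≡b (<⇒≢ a<b)) (λ equality → contradiction equality ¬equality)
  where
  a<b : a < b
  a<b = p^k∣n⇒k≤valuation {p} (valuation-increases {a = a} pp p∣x 2≤j ¬equality p^a∣xy) p^[1+b]∤N
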